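{- Let $G$ be an ordered graph and let $V(G)=X\cup Y$ be a vertex partition such that $Y$ is an independent set and $G[X]$ is induced $D$-free. Let $\gamma>0$ with $|Y|\geq 4/\gamma$. Suppose $G$ has at most $\frac{\gamma^2}{32}|X||Y|\min\{|X|,|Y|\}$ induced copies of $D$. Then $G$ can be made induced $D$-free by deleting at most $\gamma|X||Y|$ edges between $X$ and $Y$.
   Context: An ordered graph is a graph with a linear order on its vertex set. $D$ is the ordered graph with vertices $x<y<z$ and edges $\{x,y\},\{x,z\}$; an induced copy of $D$ is a triple $u<v<w$ with $\{u,v\},\{u,w\}$ edges and $\{v,w\}$ a non-edge; induced $D$-free means containing no such triple.
   Formalization: The parameter γ ranges over the positive rationals. -}

module Defs where

open import Data.Nat using (ℕ; _<_; _<ᵇ_)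
open import Data.Bool using (Bool; true; false; if_then_else_; not; _∧_)
open import Data.Fin using (Fin; toℕ)
open import Data.List using (List; map; allFin)
open import Data.Nat.ListAction using (sum)
open import Data.Product using (_×_)
open import Relation.Nullary using (¬_)
open import Relation.Binary.PropositionalEquality using (_≡_)

-- An ordered graph on vertex set Fin n, ordered by the natural order of Fin n
-- (every finite linearly ordered set is isomorphic to such).
record OrderedGraph (n : ℕ) : Set where
  field
    adj    : Fin n → Fin n → Bool
    sym    : ∀ u v → adj u v ≡ adj v u
    irrefl : ∀ u → adj u u ≡ false
open OrderedGraph public

_<F_ : ∀ {n} → Fin n → Fin n → Set
u <F v = toℕ u < toℕ v

_<Fᵇ_ : ∀ {n} → Fin n → Fin n → Bool
u <Fᵇ v = toℕ u <ᵇ toℕ v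

IsIndD : ∀ {n} → OrderedGraph n → Fin n → Fin n → Fin n → Set
IsIndD G u v w =
  u <F v × v <F w × adj G u v ≡ true × adj G u w ≡ true × adj G v w ≡ false

isIndDᵇ : ∀ {n} → OrderedGraph n → Fin n → Fin n → Fin n → Bool
isIndDᵇ G u v w =
  (u <Fᵇ v) ∧ (v <Fᵇ w) ∧ adj G u v ∧ adj G u w ∧ not (adj G v w)

count₁ : ∀ {n} → (Fin n → Bool) → ℕ
count₁ {n} P = sum (map (λ u → if P u then 1 else 0) (allFin n))

count₂ : ∀ {n} → (Fin n → Fin n → Bool) → ℕ
count₂ {n} P = sum (map (λ u → count₁ (P u)) (allFin n))

count₃ : ∀ {n} → (Fin n → Fin n → Fin n → Bool) → ℕ
count₃ {n} P = sum (map (λ u → count₂ (P u)) (allFin n))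

numIndD : ∀ {n} → OrderedGraph n → ℕ
numIndD G = count₃ (isIndDᵇ G)

IndDFreeOn : ∀ {n} → OrderedGraph n → (Fin n → Bool) → Set
IndDFreeOn G S = ∀ u v w → S u ≡ true → S v ≡ true → S w ≡ true → ¬ IsIndD G u v w

IndDFree : ∀ {n} → OrderedGraph n → Set
IndDFree G = ∀ u v w → ¬ IsIndD G u v w

Independent : ∀ {n} → OrderedGraph n → (Fin n → Bool) → Set
Independent G S = ∀ u v → S u ≡ true → S v ≡ true → adj G u v ≡ false

numDeleted : ∀ {n} → OrderedGraph n → OrderedGraph n → ℕ
numDeleted G H = count₂ (λ u v → (u <Fᵇ v) ∧ adj G u v ∧ not (adj H u v))

-- H is obtained from G by deleting some edges between X and Y
-- (X = complement of Y): H ⊆ G, and H agrees with G on pairs not between X and Y.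
DeletesXYEdges : ∀ {n} → OrderedGraph n → (Fin n → Bool) → OrderedGraph n → Set
DeletesXYEdges G Y H =
  (∀ u v → adj H u v ≡ true → adj G u v ≡ true) ×
  (∀ u v → Y u ≡ Y v → adj H u v ≡ adj G u v)

module Submission where

-- Delete every edge from x ∈ X to a later y ∈ Y: two such edges at x form an induced D with
-- apex x, since Y is independent, so the number d(x) of them satisfies d(x)² ≤ 2 D(x) + d(x),
-- where D(v) counts the induced copies of D with apex v. For y ∈ Y, keep only the edges from y
-- to a pivot p among its later neighbours and to the later neighbours of p; as G[X] is induced
-- D-free these form a clique, so no induced D remains. Taking the i-th later neighbour of y as
-- pivot loses i - 1 + r_i edges, where r_i counts the later neighbours of y after it and not
-- adjacent to it; so if the best pivot loses c(y) edges, then r_i ≥ c(y) - i + 1 for i ≤ c(y),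
-- whence c(y)(c(y)+1) ≤ 2 D(y).
-- Summing with Cauchy–Schwarz gives (Σ d)² ≤ |X| (2T + Σ d) and (Σ c)² ≤ 2 |Y| T for T the
-- number of induced D, and the hypotheses on T and |Y| turn these into Σ d + Σ c ≤ γ |X| |Y|.

open import Defs hiding (sym; irrefl)
open import Data.Nat using (ℕ)
open import Data.Bool using (Bool; true; not)
open import Data.Fin using (Fin)

module FinOrder {n : ℕ} where
  open import Data.Nat.Properties using (<⇒<ᵇ; <ᵇ⇒<)
  open import Data.Bool.Properties using (T-≡)
  open import Data.Fin using (toℕ)
  open import Data.List using (allFin)
  open import Data.List.Relation.Unary.AllPairs using (AllPairs)
  open import Data.List.Relation.Unary.AllPairs.Properties using (tabulate⁺-<)
  open import Function.Bundles using (Equivalence)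
  open import Relation.Binary.PropositionalEquality using (_≡_)

  <F⇒<Fᵇ : {u v : Fin n} → u <F v → (u <Fᵇ v) ≡ true
  <F⇒<Fᵇ u<v = Equivalence.to T-≡ (<⇒<ᵇ u<v)

  <Fᵇ⇒<F : {u v : Fin n} → (u <Fᵇ v) ≡ true → u <F v
  <Fᵇ⇒<F {u} {v} u<ᵇv = <ᵇ⇒< (toℕ u) (toℕ v) (Equivalence.from T-≡ u<ᵇv)

  allFin-sorted : AllPairs _<F_ (allFin n)
  allFin-sorted = tabulate⁺-< (λ i<j → i<j)

module Counting where
  open FinOrder
  open import Data.Nat
  open import Data.Nat.Properties
  open import Data.Nat.Tactic.RingSolver using (solve-∀)
  open import Data.Bool using (Bool; true; false; if_then_else_; _∧_)
  open import Data.List using (List; []; _∷_; map; allFin)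
  open import Data.List.Relation.Unary.All as All using (All; []; _∷_)
  open import Data.List.Relation.Unary.AllPairs using (AllPairs; []; _∷_)
  open import Data.Nat.ListAction using (sum)
  open import Data.Product using (_,_)
  open import Data.Sum using ([_,_]′)
  open import Relation.Binary.PropositionalEquality

  2mn≤m²+n² : ∀ m n → 2 * (m * n) ≤ m * m + n * n
  2mn≤m²+n² m n = [ ordered , swapped ]′ (≤-total m n)
    where
    ordered : ∀ {m n} → m ≤ n → 2 * (m * n) ≤ m * m + n * n
    ordered {m} m≤n with m≤n⇒∃[o]m+o≡n m≤n
    ... | d , refl = subst (2 * (m * (m + d)) ≤_) (identity m d) (m≤m+n _ (d * d))
      where
      identity : ∀ m d → 2 * (m * (m + d)) + d * d ≡ m * m + (m + d) * (m + d)
      identity = solve-∀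
    swapped : n ≤ m → 2 * (m * n) ≤ m * m + n * n
    swapped n≤m = subst₂ _≤_ (cong (2 *_) (*-comm n m)) (+-comm (n * n) (m * m)) (ordered n≤m)

  cauchy-schwarz-step : ∀ f s k q → s * s ≤ k * q → (f + s) * (f + s) ≤ suc k * (f * f + q)
  cauchy-schwarz-step f zero    zero q _ =
    subst₂ _≤_ (cong (λ z → z * z) (sym (+-identityʳ f))) (sym (+-identityʳ (f * f + q))) (m≤m+n (f * f) q)
  cauchy-schwarz-step f (suc s) zero q ()
  cauchy-schwarz-step f s k@(suc _) q s²≤kq = begin
    (f + s) * (f + s)                 ≡⟨ expand f s ⟩
    f * f + 2 * (f * s) + s * s       ≤⟨ +-mono-≤ (+-monoʳ-≤ (f * f) cross-term) s²≤kq ⟩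
    f * f + (q + k * (f * f)) + k * q ≡⟨ collect f k q ⟩
    suc k * (f * f + q)               ∎
    where
    open ≤-Reasoning
    expand : ∀ f s → (f + s) * (f + s) ≡ f * f + 2 * (f * s) + s * s
    expand = solve-∀
    collect : ∀ f k q → f * f + (q + k * (f * f)) + k * q ≡ suc k * (f * f + q)
    collect = solve-∀
    cross-term : 2 * (f * s) ≤ q + k * (f * f)
    cross-term = *-cancelˡ-≤ k (begin
      k * (2 * (f * s))          ≡⟨ rearrange₁ k f s ⟩
      2 * (s * (k * f))          ≤⟨ 2mn≤m²+n² s (k * f) ⟩
      s * s + (k * f) * (k * f)  ≤⟨ +-monoˡ-≤ _ s²≤kq ⟩
      k * q + (k * f) * (k * f)  ≡⟨ rearrange₂ k f q ⟩
      k * (q + k * (f * f))      ∎)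
      where
      rearrange₁ : ∀ k f s → k * (2 * (f * s)) ≡ 2 * (s * (k * f))
      rearrange₁ = solve-∀
      rearrange₂ : ∀ k f q → k * q + (k * f) * (k * f) ≡ k * (q + k * (f * f))
      rearrange₂ = solve-∀

  triangular-step : ∀ {c r f t} → c ≤ r → c ≤ suc f → f * suc f ≤ 2 * t → c * suc c ≤ 2 * (r + t)
  triangular-step {zero}                  _   _         _      = z≤n
  triangular-step {suc c} {r} {f} {t} c<r (s≤s c≤f) f≤t = begin
    suc c * suc (suc c)    ≡⟨ expand c ⟩
    c * suc c + 2 * suc c  ≤⟨ +-mono-≤ (≤-trans (*-mono-≤ c≤f (s≤s c≤f)) f≤t) (*-monoʳ-≤ 2 c<r) ⟩
    2 * t + 2 * r          ≡⟨ collect r t ⟩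
    2 * (r + t)            ∎
    where
    open ≤-Reasoning
    expand : ∀ c → suc c * suc (suc c) ≡ c * suc c + 2 * suc c
    expand = solve-∀
    collect : ∀ r t → 2 * t + 2 * r ≡ 2 * (r + t)
    collect = solve-∀

  module _ {A : Set} where

    sumOver : List A → (A → ℕ) → ℕ
    sumOver xs f = sum (map f xs)

    countIn : List A → (A → Bool) → ℕ
    countIn xs P = sumOver xs (λ x → if P x then 1 else 0)

    sumOver-cong : ∀ xs {f g : A → ℕ} → (∀ x → f x ≡ g x) → sumOver xs f ≡ sumOver xs g
    sumOver-cong []       f≡g = refl
    sumOver-cong (x ∷ xs) f≡g = cong₂ _+_ (f≡g x) (sumOver-cong xs f≡g)

    sumOver-monoᴬ : ∀ xs {f g : A → ℕ} → All (λ x → f x ≤ g x) xs → sumOver xs f ≤ sumOver xs g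
    sumOver-monoᴬ []       []           = z≤n
    sumOver-monoᴬ (x ∷ xs) (fx≤gx ∷ f≤g) = +-mono-≤ fx≤gx (sumOver-monoᴬ xs f≤g)

    sumOver-mono : ∀ xs {f g : A → ℕ} → (∀ x → f x ≤ g x) → sumOver xs f ≤ sumOver xs g
    sumOver-mono xs f≤g = sumOver-monoᴬ xs (All.universal f≤g xs)

    sumOver-+ : ∀ xs (f g : A → ℕ) → sumOver xs (λ x → f x + g x) ≡ sumOver xs f + sumOver xs g
    sumOver-+ []       f g = refl
    sumOver-+ (x ∷ xs) f g rewrite sumOver-+ xs f g = +-comm-middle (f x) (g x) (sumOver xs f) (sumOver xs g)
      where
      +-comm-middle : ∀ a b c d → (a + b) + (c + d) ≡ (a + c) + (b + d)
      +-comm-middle = solve-∀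

    sumOver-*ˡ : ∀ xs k (f : A → ℕ) → sumOver xs (λ x → k * f x) ≡ k * sumOver xs f
    sumOver-*ˡ []       k f = sym (*-zeroʳ k)
    sumOver-*ˡ (x ∷ xs) k f rewrite sumOver-*ˡ xs k f = sym (*-distribˡ-+ k (f x) (sumOver xs f))

    countIn-monoᴬ : ∀ xs {P Q : A → Bool} → All (λ x → P x ≡ true → Q x ≡ true) xs →
                    countIn xs P ≤ countIn xs Q
    countIn-monoᴬ xs P⇒Q = sumOver-monoᴬ xs (All.map indicator-mono P⇒Q)
      where
      indicator-mono : ∀ {a b : Bool} → (a ≡ true → b ≡ true) → (if a then 1 else 0) ≤ (if b then 1 else 0)
      indicator-mono {false}         _   = z≤n
      indicator-mono {true}  {true}  _   = ≤-refl
      indicator-mono {true}  {false} a⇒b with () ← a⇒b refl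

    countIn-mono : ∀ xs {P Q : A → Bool} → (∀ x → P x ≡ true → Q x ≡ true) → countIn xs P ≤ countIn xs Q
    countIn-mono xs P⇒Q = countIn-monoᴬ xs (All.universal P⇒Q xs)

    cauchy-schwarz : ∀ xs (P : A → Bool) (f : A → ℕ) →
      sumOver xs (λ x → if P x then f x else 0) * sumOver xs (λ x → if P x then f x else 0)
        ≤ countIn xs P * sumOver xs (λ x → if P x then f x * f x else 0)
    cauchy-schwarz []       P f = z≤n
    cauchy-schwarz (x ∷ xs) P f with P x
    ... | true  = cauchy-schwarz-step (f x) _ (countIn xs P) _ (cauchy-schwarz xs P f)
    ... | false = cauchy-schwarz xs P f

    pairsIn : List A → (A → A → Bool) → ℕ
    pairsIn []       Q = 0
    pairsIn (x ∷ xs) Q = countIn xs (Q x) + pairsIn xs Q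

    count²≤2*pairs+count : ∀ xs (P : A → Bool) →
      countIn xs P * countIn xs P ≤ 2 * pairsIn xs (λ v w → P v ∧ P w) + countIn xs P
    count²≤2*pairs+count []       P = z≤n
    count²≤2*pairs+count (x ∷ xs) P with P x
    ... | true  = begin
      suc c * suc c            ≡⟨ expand c ⟩
      c * c + (2 * c + 1)      ≤⟨ +-monoˡ-≤ _ (count²≤2*pairs+count xs P) ⟩
      2 * t + c + (2 * c + 1)  ≡⟨ collect c t ⟩
      2 * (c + t) + suc c      ∎
      where
      open ≤-Reasoning
      expand : ∀ c → suc c * suc c ≡ c * c + (2 * c + 1)
      expand = solve-∀
      collect : ∀ c t → 2 * t + c + (2 * c + 1) ≡ 2 * (c + t) + suc c
      collect = solve-∀
      c t : ℕ
      c = countIn xs P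
      t = pairsIn xs (λ v w → P v ∧ P w)
    ... | false = ≤-trans (count²≤2*pairs+count xs P)
                    (+-monoˡ-≤ _ (*-monoʳ-≤ 2 (m≤n+m _ (countIn xs (λ _ → false)))))

  count₂-mono : ∀ {n} {P Q : Fin n → Fin n → Bool} → (∀ u v → P u v ≡ true → Q u v ≡ true) →
                count₂ P ≤ count₂ Q
  count₂-mono {n} P⇒Q = sumOver-mono (allFin n) (λ u → countIn-mono (allFin n) (P⇒Q u))

  pairsIn-allFin≤count₂ : ∀ {n} (Q : Fin n → Fin n → Bool) →
    pairsIn (allFin n) Q ≤ count₂ (λ v w → (v <Fᵇ w) ∧ Q v w)
  pairsIn-allFin≤count₂ {n} Q = sorted (allFin n) allFin-sorted
    where
    <⇒<ᵇ-∧ : ∀ {v w} → v <F w → Q v w ≡ true → ((v <Fᵇ w) ∧ Q v w) ≡ true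
    <⇒<ᵇ-∧ v<w Qvw rewrite <F⇒<Fᵇ v<w = Qvw
    sorted : ∀ xs → AllPairs _<F_ xs →
             pairsIn xs Q ≤ sumOver xs (λ v → countIn xs (λ w → (v <Fᵇ w) ∧ Q v w))
    sorted []       []             = z≤n
    sorted (x ∷ xs) (x<xs ∷ sorted-xs) = +-mono-≤
      (≤-trans (countIn-monoᴬ xs (All.map <⇒<ᵇ-∧ x<xs)) (m≤n+m _ _))
      (≤-trans (sorted xs sorted-xs) (sumOver-mono xs (λ v → m≤n+m _ _)))

module PivotSearch {n : ℕ} (M : Fin n → Bool) (E : Fin n → Fin n → Bool) where
  open FinOrder
  open Counting
  open import Data.Nat using (suc; _*_; _≤_; z≤n; _≤?_)
  open import Data.Nat.Properties using (≤-refl; ≤-trans; +-mono-≤; *-monoʳ-≤; m≤n+m; <⇒≤; ≰⇒>)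
  open import Data.Bool using (true; false; if_then_else_; _∧_; _∨_)
  open import Data.Fin using (_≟_)
  open import Data.List using (List; []; _∷_)
  open import Data.List.Relation.Unary.All as All using (All; []; _∷_)
  open import Data.List.Relation.Unary.AllPairs using (AllPairs; []; _∷_)
  open import Data.Maybe using (Maybe; just; nothing)
  open import Data.Product using (_×_; _,_; proj₁; proj₂)
  open import Data.Fin.Properties using (<⇒≢)
  open import Relation.Nullary using (does; yes; no)
  open import Relation.Nullary.Decidable using (dec-true; dec-false)
  open import Relation.Binary.PropositionalEquality

  covers : Maybe (Fin n) → Fin n → Bool
  covers nothing  z = false
  covers (just p) z = does (z ≟ p) ∨ ((p <Fᵇ z) ∧ E p z)

  missedBy : Fin n → List (Fin n) → ℕ
  missedBy x xs = countIn xs (λ z → M z ∧ not (E x z))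

  -- A candidate p (an element satisfying M) minimising the number of candidates that p does
  -- not cover (those before p, and those after p not E-related to p), and that number.
  search : List (Fin n) → Maybe (Fin n) × ℕ
  search []       = nothing , 0
  search (x ∷ xs) with M x
  ... | false = search xs
  ... | true with missedBy x xs ≤? suc (proj₂ (search xs))
  ...   | yes _ = just x , missedBy x xs
  ...   | no _  = proj₁ (search xs) , suc (proj₂ (search xs))

  pivot : List (Fin n) → Maybe (Fin n)
  pivot xs = proj₁ (search xs)

  cost : List (Fin n) → ℕ
  cost xs = proj₂ (search xs)

  pivot-candidate : ∀ xs {p} → pivot xs ≡ just p → M p ≡ true
  pivot-candidate (x ∷ xs) eq with M x in Mx
  ... | false = pivot-candidate xs eq
  ... | true with missedBy x xs ≤? suc (cost xs)
  ...   | yes _ with refl ← eq = Mx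
  ...   | no _  = pivot-candidate xs eq

  uncovered≤cost : ∀ xs → AllPairs _<F_ xs →
                   countIn xs (λ z → M z ∧ not (covers (pivot xs) z)) ≤ cost xs
  uncovered≤cost []       []               = z≤n
  uncovered≤cost (x ∷ xs) (x<xs ∷ sorted) with M x
  ... | false = uncovered≤cost xs sorted
  ... | true with missedBy x xs ≤? suc (cost xs)
  ...   | yes _ rewrite dec-true (x ≟ x) refl = countIn-monoᴬ xs (All.map later x<xs)
    where
    later : ∀ {z} → x <F z → (M z ∧ not (covers (just x) z)) ≡ true → (M z ∧ not (E x z)) ≡ true
    later {z} x<z h rewrite dec-false (z ≟ x) (λ z≡x → <⇒≢ x<z (sym z≡x)) | <F⇒<Fᵇ x<z = h
  ...   | no _ = +-mono-≤ (indicator≤1 _) (uncovered≤cost xs sorted)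
    where
    indicator≤1 : ∀ b → (if b then 1 else 0) ≤ 1
    indicator≤1 true  = ≤-refl
    indicator≤1 false = z≤n

  cost-bound : ∀ xs → cost xs * suc (cost xs) ≤ 2 * pairsIn xs (λ v w → M v ∧ (M w ∧ not (E v w)))
  cost-bound []       = z≤n
  cost-bound (x ∷ xs) with M x
  ... | false = ≤-trans (cost-bound xs) (*-monoʳ-≤ 2 (m≤n+m _ (countIn xs (λ _ → false))))
  ... | true with missedBy x xs ≤? suc (cost xs)
  ...   | yes r≤1+f = triangular-step ≤-refl r≤1+f (cost-bound xs)
  ...   | no  r≰1+f = triangular-step (<⇒≤ (≰⇒> r≰1+f)) ≤-refl (cost-bound xs)

module Cleanup {n : ℕ} (G : OrderedGraph n) (Y : Fin n → Bool) where
  open FinOrder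
  open Counting
  open import Data.Nat using (suc; _+_; _*_; _≤_; z≤n)
  open import Data.Nat.Properties
    using ( <-irrefl; <-asym; <-trans; ≤-trans; n≤1+n; +-monoˡ-≤; *-mono-≤; *-monoʳ-≤; +-identityʳ
          ; module ≤-Reasoning)
  open import Data.Bool using (false; if_then_else_; _∧_)
  open import Data.Bool.Properties using (∧-conicalˡ; ∧-conicalʳ; ∧-inverseʳ)
  open import Data.Fin using (_≟_)
  open import Data.List using (allFin)
  open import Data.Maybe using (Maybe; just)
  open import Data.Product using (_,_)
  open import Relation.Nullary using (¬_; yes; no)
  open import Relation.Binary.PropositionalEquality

  forward : Fin n → Fin n → Bool
  forward u v = (u <Fᵇ v) ∧ adj G u v

  module Pivot (y : Fin n) = PivotSearch (forward y) (adj G)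

  pivot : Fin n → Maybe (Fin n)
  pivot y = Pivot.pivot y (allFin n)

  kept : Fin n → Fin n → Bool
  kept y x = forward y x ∧ Pivot.covers y (pivot y) x

  onParts : (Yu Yv within keptFromU keptFromV : Bool) → Bool
  onParts true  true  e _ _ = e
  onParts true  false _ k _ = k
  onParts false true  _ _ k = k
  onParts false false e _ _ = e

  H : OrderedGraph n
  H = record { adj = H-adj ; sym = H-sym ; irrefl = H-irrefl }
    where
    H-adj : Fin n → Fin n → Bool
    H-adj u v = onParts (Y u) (Y v) (adj G u v) (kept u v) (kept v u)
    H-sym : ∀ u v → H-adj u v ≡ H-adj v u
    H-sym u v with Y u | Y v
    ... | true  | true  = OrderedGraph.sym G u v
    ... | true  | false = refl
    ... | false | true  = refl
    ... | false | false = OrderedGraph.sym G u v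
    H-irrefl : ∀ u → H-adj u u ≡ false
    H-irrefl u with Y u
    ... | true  = OrderedGraph.irrefl G u
    ... | false = OrderedGraph.irrefl G u

  H-deletesXYEdges : DeletesXYEdges G Y H
  H-deletesXYEdges = subgraph , unchanged-within-parts
    where
    subgraph : ∀ u v → adj H u v ≡ true → adj G u v ≡ true
    subgraph u v h with Y u | Y v
    ... | true  | true  = h
    ... | true  | false = ∧-conicalʳ (u <Fᵇ v) _ (∧-conicalˡ (forward u v) _ h)
    ... | false | true  = trans (OrderedGraph.sym G u v) (∧-conicalʳ (v <Fᵇ u) _ (∧-conicalˡ (forward v u) _ h))
    ... | false | false = h
    unchanged-within-parts : ∀ u v → Y u ≡ Y v → adj H u v ≡ adj G u v
    unchanged-within-parts u v Yu≡Yv with Y u | Y v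
    ... | true  | true  = refl
    ... | false | false = refl

  deleted-from-Y : ∀ {u v} → Y u ≡ true →
    ((u <Fᵇ v) ∧ adj G u v ∧ not (onParts (Y u) (Y v) (adj G u v) (kept u v) (kept v u))) ≡ true →
    (forward u v ∧ not (Pivot.covers u (pivot u) v)) ≡ true
  deleted-from-Y {u} {v} Yu h rewrite Yu with Y v
  ... | true with () ← trans (sym (∧-inverseʳ (adj G u v))) (∧-conicalʳ (u <Fᵇ v) _ h)
  ... | false with u <Fᵇ v | adj G u v
  ...   | true  | true  = h

  laterYNeighbour : Fin n → Fin n → Bool
  laterYNeighbour x z = forward x z ∧ Y z

  deleted-from-X : ∀ {u v} → Y u ≡ false →
    ((u <Fᵇ v) ∧ adj G u v ∧ not (onParts (Y u) (Y v) (adj G u v) (kept u v) (kept v u))) ≡ true →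
    laterYNeighbour u v ≡ true
  deleted-from-X {u} {v} Yu h rewrite Yu with Y v
  ... | false with () ← trans (sym (∧-inverseʳ (adj G u v))) (∧-conicalʳ (u <Fᵇ v) _ h)
  ... | true with u <Fᵇ v | adj G u v
  ...   | true  | true  = refl

  laterYDegree : Fin n → ℕ
  laterYDegree x = countIn (allFin n) (laterYNeighbour x)

  uncovered : Fin n → ℕ
  uncovered y = countIn (allFin n) (λ z → forward y z ∧ not (Pivot.covers y (pivot y) z))

  deletedAtX : ℕ
  deletedAtX = sumOver (allFin n) (λ u → if not (Y u) then laterYDegree u else 0)

  deletedAtY : ℕ
  deletedAtY = sumOver (allFin n) (λ u → if Y u then uncovered u else 0)

  numDeleted≤ : numDeleted G H ≤ deletedAtX + deletedAtY
  numDeleted≤ = begin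
    numDeleted G H
      ≤⟨ sumOver-mono (allFin n) (λ u → charged u (Y u) refl) ⟩
    sumOver (allFin n) (λ u → if Y u then uncovered u else laterYDegree u)
      ≡⟨ sumOver-cong (allFin n) split ⟩
    sumOver (allFin n) (λ u → (if not (Y u) then laterYDegree u else 0) + (if Y u then uncovered u else 0))
      ≡⟨ sumOver-+ (allFin n) _ _ ⟩
    deletedAtX + deletedAtY ∎
    where
    open ≤-Reasoning
    charged : ∀ u b → Y u ≡ b →
      countIn (allFin n) (λ v → (u <Fᵇ v) ∧ adj G u v ∧ not (adj H u v))
        ≤ (if b then uncovered u else laterYDegree u)
    charged u true  Yu = countIn-mono (allFin n) (λ _ → deleted-from-Y Yu)
    charged u false Yu = countIn-mono (allFin n) (λ _ → deleted-from-X Yu)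
    split : ∀ u → (if Y u then uncovered u else laterYDegree u)
                ≡ (if not (Y u) then laterYDegree u else 0) + (if Y u then uncovered u else 0)
    split u with Y u
    ... | true  = refl
    ... | false = sym (+-identityʳ _)

  apexCount : Fin n → ℕ
  apexCount u = count₂ (isIndDᵇ G u)

  nonadjacent-forward-pair : ∀ y v w →
    ((v <Fᵇ w) ∧ (forward y v ∧ (forward y w ∧ not (adj G v w)))) ≡ true → isIndDᵇ G y v w ≡ true
  nonadjacent-forward-pair y v w h
    with y <Fᵇ v | v <Fᵇ w | y <Fᵇ w | adj G y v | adj G y w | adj G v w
  ... | true | true | true | true | true | false = refl

  uncovered²≤ : ∀ y → uncovered y * uncovered y ≤ 2 * apexCount y
  uncovered²≤ y = begin
    uncovered y * uncovered y  ≤⟨ *-mono-≤ uncovered≤cost uncovered≤cost ⟩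
    cost * cost                ≤⟨ *-monoʳ-≤ cost (n≤1+n cost) ⟩
    cost * suc cost            ≤⟨ Pivot.cost-bound y (allFin n) ⟩
    2 * pairsIn (allFin n) Q   ≤⟨ *-monoʳ-≤ 2 pairs≤apexCount ⟩
    2 * apexCount y            ∎
    where
    open ≤-Reasoning
    cost : ℕ
    cost = Pivot.cost y (allFin n)
    uncovered≤cost : uncovered y ≤ cost
    uncovered≤cost = Pivot.uncovered≤cost y (allFin n) allFin-sorted
    Q : Fin n → Fin n → Bool
    Q v w = forward y v ∧ (forward y w ∧ not (adj G v w))
    pairs≤apexCount : pairsIn (allFin n) Q ≤ apexCount y
    pairs≤apexCount = ≤-trans (pairsIn-allFin≤count₂ Q) (count₂-mono (nonadjacent-forward-pair y))

  deletedAtY²≤ : deletedAtY * deletedAtY ≤ count₁ Y * (2 * numIndD G)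
  deletedAtY²≤ = ≤-trans (cauchy-schwarz (allFin n) Y uncovered) (*-monoʳ-≤ (count₁ Y) (begin
    sumOver (allFin n) (λ y → if Y y then uncovered y * uncovered y else 0) ≤⟨ sumOver-mono (allFin n) termwise ⟩
    sumOver (allFin n) (λ y → 2 * apexCount y)                               ≡⟨ sumOver-*ˡ (allFin n) 2 apexCount ⟩
    2 * numIndD G                                                             ∎))
    where
    open ≤-Reasoning
    termwise : ∀ y → (if Y y then uncovered y * uncovered y else 0) ≤ 2 * apexCount y
    termwise y with Y y
    ... | true  = uncovered²≤ y
    ... | false = z≤n

  module _ (independent : Independent G Y) (X-free : IndDFreeOn G (λ u → not (Y u))) where

    forward-in-X : ∀ {y z} → Y y ≡ true → forward y z ≡ true → Y z ≡ false
    forward-in-X {y} {z} Yy yz with Y z in Yz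
    ... | false = refl
    ... | true with () ← trans (sym (∧-conicalʳ (y <Fᵇ z) _ yz)) (independent y z Yy Yz)

    covered-pairwise-adjacent : ∀ {p v w} → Y p ≡ false → Y v ≡ false → Y w ≡ false → v <F w →
      Pivot.covers p (just p) v ≡ true → Pivot.covers p (just p) w ≡ true → ¬ adj G v w ≡ false
    covered-pairwise-adjacent {p} {v} {w} Yp Yv Yw v<w pv pw vw with v ≟ p | w ≟ p
    ... | yes refl | yes refl = <-irrefl refl v<w
    ... | yes refl | no _     with () ← trans (sym (∧-conicalʳ (v <Fᵇ w) _ pw)) vw
    ... | no _     | yes refl = <-asym v<w (<Fᵇ⇒<F (∧-conicalˡ (w <Fᵇ v) _ pv))
    ... | no _     | no _     = X-free p v w (cong not Yp) (cong not Yv) (cong not Yw)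
      ( <Fᵇ⇒<F (∧-conicalˡ (p <Fᵇ v) _ pv) , v<w
      , ∧-conicalʳ (p <Fᵇ v) _ pv , ∧-conicalʳ (p <Fᵇ w) _ pw , vw)

    kept-pairwise-adjacent : ∀ {y v w} → Y y ≡ true → v <F w → kept y v ≡ true → kept y w ≡ true →
                             ¬ adj G v w ≡ false
    kept-pairwise-adjacent {y} {v} {w} Yy v<w yv yw
      with pivot y in pivot≡ | ∧-conicalʳ (forward y v) _ yv | ∧-conicalʳ (forward y w) _ yw
    ... | just p | pv | pw = covered-pairwise-adjacent
      (forward-in-X Yy (Pivot.pivot-candidate y (allFin n) pivot≡))
      (forward-in-X Yy (∧-conicalˡ (forward y v) _ yv)) (forward-in-X Yy (∧-conicalˡ (forward y w) _ yw)) v<w pv pw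

    H-indDFree : IndDFree H
    H-indDFree u v w (u<v , v<w , uv , uw , vw) with Y u in Yu | Y v in Yv | Y w in Yw
    ... | true  | true  | _     with () ← trans (sym uv) (independent u v Yu Yv)
    ... | true  | false | true  with () ← trans (sym uw) (independent u w Yu Yw)
    ... | true  | false | false = kept-pairwise-adjacent Yu v<w uv uw vw
    ... | false | true  | _     = <-asym u<v (<Fᵇ⇒<F (∧-conicalˡ (v <Fᵇ u) _ (∧-conicalˡ (forward v u) _ uv)))
    ... | false | false | true  =
      <-asym (<-trans u<v v<w) (<Fᵇ⇒<F (∧-conicalˡ (w <Fᵇ u) _ (∧-conicalˡ (forward w u) _ uw)))
    ... | false | false | false = X-free u v w (cong not Yu) (cong not Yv) (cong not Yw) (u<v , v<w , uv , uw , vw)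

    laterY-pair : ∀ x v w → ((v <Fᵇ w) ∧ (laterYNeighbour x v ∧ laterYNeighbour x w)) ≡ true →
                  isIndDᵇ G x v w ≡ true
    laterY-pair x v w h with x <Fᵇ v | v <Fᵇ w | x <Fᵇ w | adj G x v | adj G x w | Y v in Yv | Y w in Yw
    ... | true | true | true | true | true | true | true rewrite independent v w Yv Yw = refl

    laterYDegree²≤ : ∀ x → laterYDegree x * laterYDegree x ≤ 2 * apexCount x + laterYDegree x
    laterYDegree²≤ x = ≤-trans (count²≤2*pairs+count (allFin n) (laterYNeighbour x))
      (+-monoˡ-≤ _ (*-monoʳ-≤ 2 (≤-trans (pairsIn-allFin≤count₂ Q) (count₂-mono (laterY-pair x)))))
      where
      Q : Fin n → Fin n → Bool
      Q v w = laterYNeighbour x v ∧ laterYNeighbour x w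

    deletedAtX²≤ : deletedAtX * deletedAtX ≤ count₁ (λ u → not (Y u)) * (2 * numIndD G + deletedAtX)
    deletedAtX²≤ = ≤-trans (cauchy-schwarz (allFin n) (λ u → not (Y u)) laterYDegree)
      (*-monoʳ-≤ (count₁ (λ u → not (Y u))) (begin
        sumOver (allFin n) (λ x → if not (Y x) then laterYDegree x * laterYDegree x else 0)
          ≤⟨ sumOver-mono (allFin n) termwise ⟩
        sumOver (allFin n) (λ x → 2 * apexCount x + (if not (Y x) then laterYDegree x else 0))
          ≡⟨ sumOver-+ (allFin n) (λ x → 2 * apexCount x) _ ⟩
        sumOver (allFin n) (λ x → 2 * apexCount x) + deletedAtX
          ≡⟨ cong (_+ deletedAtX) (sumOver-*ˡ (allFin n) 2 apexCount) ⟩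
        2 * numIndD G + deletedAtX ∎))
      where
      open ≤-Reasoning
      termwise : ∀ x → (if not (Y x) then laterYDegree x * laterYDegree x else 0)
                       ≤ 2 * apexCount x + (if not (Y x) then laterYDegree x else 0)
      termwise x with Y x
      ... | true  = z≤n
      ... | false = laterYDegree²≤ x

module RationalBound where
  import Data.Nat as ℕ
  import Data.Nat.Properties as ℕ
  import Data.Integer as ℤ
  import Data.Integer.Properties as ℤ
  open import Data.Nat.Tactic.RingSolver using (solve-∀)
  open import Data.Nat.Coprimality using (1-coprimeTo) renaming (sym to coprime-sym)
  open import Data.Rational
  open import Data.Rational.Properties
  open import Data.Rational.Solver using (module +-*-Solver)
  open +-*-Solver using (solve; _:+_; _:*_; _:=_; con)
  open import Relation.Binary.PropositionalEquality
  open import Relation.Nullary using (yes; no)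
  open import Data.Empty using (⊥-elim)

  fromℕ : ℕ → ℚ
  fromℕ k = ℤ.+ k / 1

  fromℕ≡mkℚ : ∀ k → fromℕ k ≡ mkℚ (ℤ.+ k) 0 (coprime-sym (1-coprimeTo k))
  fromℕ≡mkℚ k = fromℚᵘ-toℚᵘ (mkℚ (ℤ.+ k) 0 (coprime-sym (1-coprimeTo k)))

  fromℕ-* : ∀ a b → fromℕ (a ℕ.* b) ≡ fromℕ a * fromℕ b
  fromℕ-* a b = trans (cong (_/ 1) (ℤ.pos-* a b)) (sym (cong₂ _*_ (fromℕ≡mkℚ a) (fromℕ≡mkℚ b)))

  fromℕ-+ : ∀ a b → fromℕ (a ℕ.+ b) ≡ fromℕ a + fromℕ b
  fromℕ-+ a b = trans
    (cong (_/ 1) (trans (ℤ.pos-+ a b) (sym (cong₂ ℤ._+_ (ℤ.*-identityʳ (ℤ.+ a)) (ℤ.*-identityʳ (ℤ.+ b))))))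
    (sym (cong₂ _+_ (fromℕ≡mkℚ a) (fromℕ≡mkℚ b)))

  fromℕ-mono-≤ : ∀ {a b} → a ℕ.≤ b → fromℕ a ≤ fromℕ b
  fromℕ-mono-≤ {a} {b} a≤b = subst₂ _≤_ (sym (fromℕ≡mkℚ a)) (sym (fromℕ≡mkℚ b))
    (*≤* (subst₂ ℤ._≤_ (sym (ℤ.*-identityʳ (ℤ.+ a))) (sym (ℤ.*-identityʳ (ℤ.+ b))) (ℤ.+≤+ a≤b)))

  0≤fromℕ : ∀ a → 0ℚ ≤ fromℕ a
  0≤fromℕ a = fromℕ-mono-≤ {0} {a} ℕ.z≤n

  0≤* : ∀ {p q} → 0ℚ ≤ p → 0ℚ ≤ q → 0ℚ ≤ p * q
  0≤* {p} {q} 0≤p 0≤q = nonNegative⁻¹ (p * q) {{nonNeg*nonNeg⇒nonNeg p {{nonNegative 0≤p}} q {{nonNegative 0≤q}}}}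

  *-monoˡ-≤-0≤ : ∀ r {p q} → 0ℚ ≤ r → p ≤ q → r * p ≤ r * q
  *-monoˡ-≤-0≤ r 0≤r = *-monoˡ-≤-nonNeg r {{nonNegative 0≤r}}

  *-monoʳ-≤-0≤ : ∀ r {p q} → 0ℚ ≤ r → p ≤ q → p * r ≤ q * r
  *-monoʳ-≤-0≤ r 0≤r = *-monoʳ-≤-nonNeg r {{nonNegative 0≤r}}

  x²≤Lx+L²⇒x≤2L : ∀ x L → 0ℚ ≤ L → x * x ≤ L * x + L * L → x ≤ L + L
  x²≤Lx+L²⇒x≤2L x L 0≤L x²≤Lx+L² with x ≤? L + L
  ... | yes x≤2L = x≤2L
  ... | no  x≰2L = ⊥-elim (<-irrefl refl (≤-<-trans x²≤Lx+L² (≤-<-trans Lx+L²≤2Lx 2Lx<x²)))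
    where
    2L<x : L + L < x
    2L<x = ≰⇒> x≰2L
    L≤2L : L ≤ L + L
    L≤2L = subst (_≤ L + L) (+-identityʳ L) (+-monoʳ-≤ L 0≤L)
    L≤x : L ≤ x
    L≤x = ≤-trans L≤2L (<⇒≤ 2L<x)
    0<x : 0ℚ < x
    0<x = ≤-<-trans (≤-trans 0≤L L≤2L) 2L<x
    2Lx<x² : (L + L) * x < x * x
    2Lx<x² = *-monoˡ-<-pos x {{positive 0<x}} 2L<x
    Lx+L²≤2Lx : L * x + L * L ≤ (L + L) * x
    Lx+L²≤2Lx = subst (L * x + L * L ≤_) (sym (*-distribʳ-+ x L L))
                  (+-monoʳ-≤ (L * x) (*-monoˡ-≤-0≤ L 0≤L L≤x))

  sum≤K : ∀ {a b S C T} K → 0ℚ ≤ K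
    → fromℕ (4 ℕ.* a) ≤ K
    → fromℕ (a ℕ.* (32 ℕ.* T)) ≤ K * K
    → fromℕ (b ℕ.* (32 ℕ.* T)) ≤ K * K
    → S ℕ.* S ℕ.≤ a ℕ.* (2 ℕ.* T ℕ.+ S)
    → C ℕ.* C ℕ.≤ b ℕ.* (2 ℕ.* T)
    → fromℕ (S ℕ.+ C) ≤ K
  sum≤K {a} {b} {S} {C} {T} K 0≤K 4a≤K 32aT≤K² 32bT≤K² S²≤ C²≤ = *-cancelˡ-≤-pos (fromℕ 4) (begin
    fromℕ 4 * fromℕ (S ℕ.+ C)  ≡⟨ sym (fromℕ-* 4 (S ℕ.+ C)) ⟩
    fromℕ (4 ℕ.* (S ℕ.+ C))    ≡⟨ trans (cong fromℕ (ℕ.*-distribˡ-+ 4 S C))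
                                        (fromℕ-+ (4 ℕ.* S) (4 ℕ.* C)) ⟩
    x + y                      ≤⟨ +-mono-≤ (x²≤Lx+L²⇒x≤2L x K 0≤K x²≤Kx+K²)
                                           (x²≤Lx+L²⇒x≤2L y K 0≤K y²≤Ky+K²) ⟩
    (K + K) + (K + K)          ≡⟨ solve 1 (λ k → (k :+ k) :+ (k :+ k) := con (fromℕ 4) :* k) refl K ⟩
    fromℕ 4 * K                ∎)
    where
    open ≤-Reasoning
    x y : ℚ
    x = fromℕ (4 ℕ.* S)
    y = fromℕ (4 ℕ.* C)
    aT : ℕ
    aT = a ℕ.* (32 ℕ.* T)
    square-4* : ∀ S → 16 ℕ.* (S ℕ.* S) ≡ (4 ℕ.* S) ℕ.* (4 ℕ.* S)
    square-4* = solve-∀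
    x²≤Kx+K² : x * x ≤ K * x + K * K
    x²≤Kx+K² = begin
      x * x                                  ≡⟨ sym (fromℕ-* (4 ℕ.* S) (4 ℕ.* S)) ⟩
      fromℕ ((4 ℕ.* S) ℕ.* (4 ℕ.* S))        ≤⟨ fromℕ-mono-≤ 16S²≤ ⟩
      fromℕ (aT ℕ.+ (4 ℕ.* a) ℕ.* (4 ℕ.* S)) ≡⟨ trans (fromℕ-+ aT _)
                                                  (cong (fromℕ aT +_) (fromℕ-* (4 ℕ.* a) (4 ℕ.* S))) ⟩
      fromℕ aT + fromℕ (4 ℕ.* a) * x         ≤⟨ +-mono-≤ 32aT≤K²
                                                  (*-monoʳ-≤-0≤ x (0≤fromℕ (4 ℕ.* S)) 4a≤K) ⟩
      K * K + K * x                          ≡⟨ +-comm (K * K) (K * x) ⟩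
      K * x + K * K                          ∎
      where
      16S²≤ : (4 ℕ.* S) ℕ.* (4 ℕ.* S) ℕ.≤ aT ℕ.+ (4 ℕ.* a) ℕ.* (4 ℕ.* S)
      16S²≤ = subst₂ ℕ._≤_ (square-4* S) (times16 a T S) (ℕ.*-monoʳ-≤ 16 S²≤)
        where
        times16 : ∀ a T S →
                  16 ℕ.* (a ℕ.* (2 ℕ.* T ℕ.+ S)) ≡ a ℕ.* (32 ℕ.* T) ℕ.+ (4 ℕ.* a) ℕ.* (4 ℕ.* S)
        times16 = solve-∀
    y²≤Ky+K² : y * y ≤ K * y + K * K
    y²≤Ky+K² = begin
      y * y                            ≡⟨ sym (fromℕ-* (4 ℕ.* C) (4 ℕ.* C)) ⟩
      fromℕ ((4 ℕ.* C) ℕ.* (4 ℕ.* C))  ≤⟨ fromℕ-mono-≤ 16C²≤ ⟩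
      fromℕ (b ℕ.* (32 ℕ.* T))         ≤⟨ 32bT≤K² ⟩
      K * K                            ≡⟨ sym (+-identityˡ (K * K)) ⟩
      0ℚ + K * K                       ≤⟨ +-monoˡ-≤ (K * K) (0≤* 0≤K (0≤fromℕ (4 ℕ.* C))) ⟩
      K * y + K * K                    ∎
      where
      times16 : ∀ b T → 16 ℕ.* (b ℕ.* (2 ℕ.* T)) ≡ b ℕ.* (32 ℕ.* T)
      times16 = solve-∀
      16C²≤ : (4 ℕ.* C) ℕ.* (4 ℕ.* C) ℕ.≤ b ℕ.* (32 ℕ.* T)
      16C²≤ = subst₂ ℕ._≤_ (square-4* C) (times16 b T) (ℕ.*-monoʳ-≤ 16 C²≤)

  deletion-bound : ∀ a b S C T m (γ : ℚ) .{{_ : Positive γ}} .{{_ : NonZero γ}}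
    → (ℤ.+ 4 / 1) ÷ γ ≤ fromℕ b
    → fromℕ T ≤ ((γ * γ) ÷ (ℤ.+ 32 / 1)) * (fromℕ a * (fromℕ b * fromℕ m))
    → m ℕ.≤ a → m ℕ.≤ b
    → S ℕ.* S ℕ.≤ a ℕ.* (2 ℕ.* T ℕ.+ S)
    → C ℕ.* C ℕ.≤ b ℕ.* (2 ℕ.* T)
    → fromℕ (S ℕ.+ C) ≤ γ * (fromℕ a * fromℕ b)
  deletion-bound a b S C T m γ 4/γ≤b T≤ m≤a m≤b =
    sum≤K {a} {b} {S} {C} {T} K 0≤K 4a≤K (32T≤ a b m≤b refl) (32T≤ b a m≤a (*-comm B A))
    where
    A B M K E : ℚ
    A = fromℕ a
    B = fromℕ b
    M = fromℕ m
    K = γ * (A * B)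
    E = γ * γ
    0≤γ : 0ℚ ≤ γ
    0≤γ = nonNegative⁻¹ γ {{pos⇒nonNeg γ}}
    0≤K : 0ℚ ≤ K
    0≤K = 0≤* 0≤γ (0≤* (0≤fromℕ a) (0≤fromℕ b))
    4≤γB : fromℕ 4 ≤ γ * B
    4≤γB = subst (_≤ γ * B) γ*4/γ≡4 (*-monoˡ-≤-0≤ γ 0≤γ 4/γ≤b)
      where
      γ*4/γ≡4 : γ * ((ℤ.+ 4 / 1) ÷ γ) ≡ fromℕ 4
      γ*4/γ≡4 = trans (solve 3 (λ g f i → g :* (f :* i) := f :* (g :* i)) refl γ (fromℕ 4) (1/ γ))
                  (trans (cong (fromℕ 4 *_) (*-inverseʳ γ)) (*-identityʳ (fromℕ 4)))
    4a≤K : fromℕ (4 ℕ.* a) ≤ K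
    4a≤K = subst₂ _≤_ (sym (fromℕ-* 4 a)) (solve 3 (λ g b a → (g :* b) :* a := g :* (a :* b)) refl γ B A)
             (*-monoʳ-≤-0≤ A (0≤fromℕ a) 4≤γB)
    32T≤EABM : fromℕ (32 ℕ.* T) ≤ E * (A * (B * M))
    32T≤EABM = subst₂ _≤_ (sym (fromℕ-* 32 T)) cancel32 (*-monoˡ-≤-0≤ (fromℕ 32) (0≤fromℕ 32) T≤)
      where
      cancel32 : fromℕ 32 * ((E ÷ (ℤ.+ 32 / 1)) * (A * (B * M))) ≡ E * (A * (B * M))
      cancel32 = trans
        (solve 4 (λ t e i p → t :* ((e :* i) :* p) := (t :* i) :* (e :* p)) refl (fromℕ 32) E (1/ fromℕ 32) (A * (B * M)))
        (trans (cong (_* (E * (A * (B * M)))) (*-inverseʳ (fromℕ 32))) (*-identityˡ _))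
    32T≤ : ∀ z w → m ℕ.≤ w → fromℕ z * fromℕ w ≡ A * B → fromℕ (z ℕ.* (32 ℕ.* T)) ≤ K * K
    32T≤ z w m≤w ZW≡AB = begin
      fromℕ (z ℕ.* (32 ℕ.* T))         ≡⟨ fromℕ-* z (32 ℕ.* T) ⟩
      Z * fromℕ (32 ℕ.* T)             ≤⟨ *-monoˡ-≤-0≤ Z (0≤fromℕ z) 32T≤EABM ⟩
      Z * (E * (A * (B * M)))          ≡⟨ solve 5 (λ z g a b m →
                                            z :* ((g :* g) :* (a :* (b :* m))) := z :* ((g :* g) :* (a :* b)) :* m)
                                            refl Z γ A B M ⟩
      Z * (E * (A * B)) * M            ≤⟨ *-monoˡ-≤-0≤ (Z * (E * (A * B))) 0≤ZEAB (fromℕ-mono-≤ m≤w) ⟩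
      Z * (E * (A * B)) * fromℕ w      ≡⟨ solve 5 (λ z g a b w →
                                            z :* ((g :* g) :* (a :* b)) :* w := (g :* g) :* (a :* b) :* (z :* w))
                                            refl Z γ A B (fromℕ w) ⟩
      E * (A * B) * (Z * fromℕ w)      ≡⟨ cong (E * (A * B) *_) ZW≡AB ⟩
      E * (A * B) * (A * B)            ≡⟨ solve 3 (λ g a b →
                                            (g :* g) :* (a :* b) :* (a :* b) := (g :* (a :* b)) :* (g :* (a :* b)))
                                            refl γ A B ⟩
      K * K                            ∎
      where
      open ≤-Reasoning
      Z : ℚ
      Z = fromℕ z
      0≤ZEAB : 0ℚ ≤ Z * (E * (A * B))
      0≤ZEAB = 0≤* (0≤fromℕ z) (0≤* (0≤* 0≤γ 0≤γ) (0≤* (0≤fromℕ a) (0≤fromℕ b)))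

open import Data.Nat using (_⊓_)
open import Data.Nat.Properties using (m⊓n≤m; m⊓n≤n)
open import Data.Integer using (+_)
open import Data.Product using (Σ; _×_; _,_)
open import Data.Rational using (ℚ; Positive; NonZero; _≤_; _*_; _/_; _÷_)
open import Data.Rational.Properties using (≤-trans)
open import Relation.Binary.PropositionalEquality using (_≡_)

lemma2p12 : ∀ (n : ℕ) (G : OrderedGraph n) (Y : Fin n → Bool)
    → Independent G Y
    → IndDFreeOn G (λ u → not (Y u))
    → (γ : ℚ) → .{{_ : Positive γ}} → .{{_ : NonZero γ}}
    → (+ 4 / 1) ÷ γ ≤ + count₁ Y / 1
    → + numIndD G / 1 ≤ ((γ * γ) ÷ (+ 32 / 1)) * ((+ count₁ (λ u → not (Y u)) / 1) * ((+ count₁ Y / 1) * (+ (count₁ (λ u → not (Y u)) ⊓ count₁ Y) / 1)))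
    → Σ (OrderedGraph n) (λ H → DeletesXYEdges G Y H × IndDFree H × (+ numDeleted G H / 1) ≤ γ * ((+ count₁ (λ u → not (Y u)) / 1) * (+ count₁ Y / 1)))
lemma2p12 n G Y independent X-free γ 4/γ≤|Y| few-copies =
  H , H-deletesXYEdges , H-indDFree independent X-free ,
  ≤-trans (fromℕ-mono-≤ numDeleted≤)
          (deletion-bound |X| |Y| deletedAtX deletedAtY (numIndD G) (|X| ⊓ |Y|) γ 4/γ≤|Y| few-copies
            (m⊓n≤m |X| |Y|) (m⊓n≤n |X| |Y|) (deletedAtX²≤ independent X-free) deletedAtY²≤)
  where
  open Cleanup G Y
  open RationalBound using (fromℕ-mono-≤; deletion-bound)
  |X| |Y| : ℕ
  |X| = count₁ (λ u → not (Y u))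
  |Y| = count₁ Y
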